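{- Consider the MaximumProtocol described in the context, run with parameter $N\ge n$ by $n$ nodes holding pairwise distinct values, and index the nodes so that $v_1>v_2>\dots>v_n$. Let $X_i$ be the indicator that node $i$ sends a message to the coordinator during the run. Then \[\Pr[X_i=1]\le\frac1N+\sum_{r=1}^{\log N}\frac{2^r}{N}\left(1-\frac{2^{r-1}}{N}\right)^i.\]
   Context: MaximumProtocol with parameter $N\ge n$ (logarithms are base 2): initially all nodes are active, and $max_{ -1}=-\infty$. For rounds $r=0,1,\dots,\log N$: each active node $i$ with $v_i<max_{r-1}$ does nothing this round; every other active node independently flips a coin with success probability $2^r/N$ and on success sends $(i,v_i)$ to the coordinator and becomes inactive. At the end of round $r$ the coordinator broadcasts the maximum $max_r$ of all values it has received so far. -}

module Defs where

open import Data.Nat as ℕ using (ℕ; zero; suc; NonZero; _^_)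
open import Data.Nat.Logarithm using (⌊log₂_⌋)
open import Data.Integer as ℤ using (ℤ; +_)
open import Data.Rational as ℚ using (ℚ; 0ℚ; 1ℚ)
open import Data.Fin as Fin using (Fin)
open import Data.List using (List; []; _∷_; concatMap; map; upTo; allFin)
open import Data.Product using (_×_; _,_)
open import Data.Bool using (Bool; true; false; if_then_else_; not)
open import Data.Maybe using (Maybe; nothing; just)
open import Relation.Nullary.Decidable using (⌊_⌋)

Dist : Set → Set
Dist A = List (ℚ × A)

return : {A : Set} → A → Dist A
return a = (1ℚ , a) ∷ []

bind : {A B : Set} → Dist A → (A → Dist B) → Dist B
bind d f = concatMap (λ { (p , a) → map (λ { (q , b) → (p ℚ.* q , b) }) (f a) }) d

coin : ℚ → Dist Bool
coin p = (p , true) ∷ (1ℚ ℚ.- p , false) ∷ []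

Pr : {A : Set} → Dist A → (A → Bool) → ℚ
Pr [] E = 0ℚ
Pr ((p , a) ∷ d) E = (if E a then p else 0ℚ) ℚ.+ Pr d E

_^ℚ_ : ℚ → ℕ → ℚ
q ^ℚ zero = 1ℚ
q ^ℚ suc k = q ℚ.* (q ^ℚ k)

-- MaximumProtocol
-- State: which nodes are still active, and the maximum of all values
-- received by the coordinator so far (nothing = -∞).

State : ℕ → Set
State n = (Fin n → Bool) × Maybe ℤ

below : Maybe ℤ → ℤ → Bool
below nothing  x = false
below (just m) x = ⌊ x ℤ.<? m ⌋

insertMax : Maybe ℤ → ℤ → Maybe ℤ
insertMax nothing  x = just x
insertMax (just m) x = just (m ℤ.⊔ x)

deactivate : {n : ℕ} → Fin n → (Fin n → Bool) → (Fin n → Bool)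
deactivate j act k = if ⌊ k Fin.≟ j ⌋ then false else act k

-- action of node j in a round; prev = max_{r-1} broadcast at end of previous round,
-- p = success probability of the coin in this round
stepNode : {n : ℕ} → (Fin n → ℤ) → ℚ → Maybe ℤ → Fin n → State n → Dist (State n)
stepNode v p prev j (act , best) with act j | below prev (v j)
... | true | false =
  bind (coin p) (λ b → if b then return (deactivate j act , insertMax best (v j))
                            else return (act , best))
... | _ | _ = return (act , best)

-- one round: all nodes act (independently) against the fixed value prev;
-- the resulting best is the broadcast max_r
roundNodes : {n : ℕ} → (Fin n → ℤ) → ℚ → Maybe ℤ → List (Fin n) → State n → Dist (State n)
roundNodes v p prev [] s = return s
roundNodes v p prev (j ∷ js) s = bind (stepNode v p prev j s) (roundNodes v p prev js)

doRound : {n : ℕ} → (Fin n → ℤ) → ℚ → State n → Dist (State n)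
doRound {n} v p (act , best) = roundNodes v p best (allFin n) (act , best)

coinProb : (N r : ℕ) → .{{_ : NonZero N}} → ℚ
coinProb N r = (+ (2 ^ r)) ℚ./ N

runRounds : {n : ℕ} → (N : ℕ) → .{{_ : NonZero N}} → (Fin n → ℤ) → List ℕ → State n → Dist (State n)
runRounds N v [] s = return s
runRounds N v (r ∷ rs) s = bind (doRound v (coinProb N r) s) (runRounds N v rs)

initial : (n : ℕ) → State n
initial n = (λ _ → true) , nothing

maximumProtocol : {n : ℕ} → (N : ℕ) → .{{_ : NonZero N}} → (Fin n → ℤ) → Dist (State n)
maximumProtocol {n} N v = runRounds N v (upTo (suc ⌊log₂ N ⌋)) (initial n)

-- X_i = 1 : node i has sent its message (is no longer active) at the end
sent : {n : ℕ} → Fin n → State n → Bool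
sent i (act , best) = not (act i)

sumFrom1 : ℕ → (ℕ → ℚ) → ℚ
sumFrom1 zero f = 0ℚ
sumFrom1 (suc L) f = sumFrom1 L f ℚ.+ f (suc L)

module Submission where

-- Fix a node i (0-indexed: nodes 0..i are the i+1 nodes whose value is at least
-- v i).  A state is scored by the potential Φ h: it is 1 if i has already sent,
-- 0 if i is dominated (its value lies below the broadcast maximum, so it never
-- sends), h if i is fresh (active, undominated, and every node of larger value is
-- still active), and the trivial bound 1 otherwise.  The heart of the proof is the
-- round lemma: a round with coin probability p maps Φ h to at most
-- Φ (p + (1-p)^(i+1) h).  Indeed, from a fresh state i sends with probability p, it
-- stays fresh only if none of the i+1 coins of nodes 0..i succeeds, and nodes of
-- smaller value never affect i.  Iterating over the rounds r = 0..log N bounds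
-- Pr[i sends] by the Horner expression P₀ + Q₀(P₁ + Q₁(P₂ + ...)) with
-- Pᵣ = 2^r/N and Qᵣ = (1-Pᵣ)^(i+1); since every Qᵣ lies in [0,1], this is at most
-- P₀ + Σ_{r ≥ 1} Pᵣ Qᵣ₋₁, the claimed bound.

open import Defs
open import Data.Nat as ℕ using (ℕ; suc; NonZero; _∸_)
open import Data.Nat.Logarithm using (⌊log₂_⌋)
open import Data.Integer as ℤ using (ℤ; +_)
open import Data.Rational as ℚ using (ℚ; 1ℚ)
open import Data.Fin as Fin using (Fin; toℕ)

open import Data.Nat using (zero)
import Data.Nat.Properties as ℕP
import Data.Nat.DivMod as ℕDM
import Data.Nat.GCD as ℕGCD
open import Data.Nat.Logarithm.Core using (⌊log2⌋)
import Data.Integer.Properties as ℤP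
open import Data.Rational using (0ℚ; normalize)
open import Data.Rational.Properties as ℚP using (≤-refl; ≤-trans; ≤-reflexive)
open import Data.Rational.Solver using (module +-*-Solver)
import Data.Fin.Properties as FinP
open import Data.Bool using (Bool; true; false; if_then_else_; not)
import Data.Bool.Properties as BoolP
open import Data.List using (List; []; _∷_; _++_; map; applyUpTo; upTo; allFin; length; tabulate)
import Data.List.Properties as ListP
open import Data.List.Relation.Unary.All as All using (All; []; _∷_)
import Data.List.Relation.Unary.All.Properties as AllP
open import Data.Maybe using (Maybe; just; nothing)
open import Data.Product using (_×_; _,_; proj₁; proj₂)
open import Data.Sum using (_⊎_; inj₁; inj₂)
open import Data.Unit using (⊤; tt)
open import Data.Empty using (⊥-elim)
open import Function using (_∘_; id)
open import Induction.WellFounded using (Acc; acc)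
open import Relation.Nullary using (Dec; yes; no; ¬_)
open import Relation.Nullary.Decidable using (⌊_⌋; _→-dec_)
open import Relation.Binary.PropositionalEquality
  using (_≡_; refl; sym; trans; cong; cong₂; subst; subst₂; module ≡-Reasoning)

𝔼 : {A : Set} → Dist A → (A → ℚ) → ℚ
𝔼 []            V = 0ℚ
𝔼 ((p , a) ∷ d) V = p ℚ.* V a ℚ.+ 𝔼 d V

𝔼-++ : {A : Set} (d e : Dist A) (V : A → ℚ) → 𝔼 (d ++ e) V ≡ 𝔼 d V ℚ.+ 𝔼 e V
𝔼-++ []            e V = sym (ℚP.+-identityˡ _)
𝔼-++ ((p , a) ∷ d) e V =
  trans (cong (p ℚ.* V a ℚ.+_) (𝔼-++ d e V)) (sym (ℚP.+-assoc (p ℚ.* V a) (𝔼 d V) (𝔼 e V)))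

𝔼-scale : {A : Set} (p : ℚ) (g : ℚ × A → ℚ × A) → (∀ q b → g (q , b) ≡ (p ℚ.* q , b)) →
          (d : Dist A) (V : A → ℚ) → 𝔼 (map g d) V ≡ p ℚ.* 𝔼 d V
𝔼-scale p g scales []            V = sym (ℚP.*-zeroʳ p)
𝔼-scale p g scales ((q , b) ∷ d) V rewrite scales q b = begin
  p ℚ.* q ℚ.* V b ℚ.+ 𝔼 (map g d) V
    ≡⟨ cong₂ ℚ._+_ (ℚP.*-assoc p q (V b)) (𝔼-scale p g scales d V) ⟩
  p ℚ.* (q ℚ.* V b) ℚ.+ p ℚ.* 𝔼 d V
    ≡⟨ sym (ℚP.*-distribˡ-+ p (q ℚ.* V b) (𝔼 d V)) ⟩
  p ℚ.* (q ℚ.* V b ℚ.+ 𝔼 d V) ∎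
  where open ≡-Reasoning

𝔼-bind : {A B : Set} (d : Dist A) (f : A → Dist B) (V : B → ℚ) →
         𝔼 (bind d f) V ≡ 𝔼 d (λ a → 𝔼 (f a) V)
𝔼-bind []            f V = refl
𝔼-bind ((p , a) ∷ d) f V =
  trans (𝔼-++ (map _ (f a)) (bind d f) V)
        (cong₂ ℚ._+_ (𝔼-scale p _ (λ _ _ → refl) (f a) V) (𝔼-bind d f V))

𝔼-return : {A : Set} (a : A) (V : A → ℚ) → 𝔼 (return a) V ≡ V a
𝔼-return a V = trans (ℚP.+-identityʳ _) (ℚP.*-identityˡ _)

𝔼-cong : {A : Set} (d : Dist A) {V W : A → ℚ} → (∀ a → V a ≡ W a) → 𝔼 d V ≡ 𝔼 d W
𝔼-cong []            V≗W = refl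
𝔼-cong ((p , a) ∷ d) V≗W = cong₂ (λ x y → p ℚ.* x ℚ.+ y) (V≗W a) (𝔼-cong d V≗W)

indicator : Bool → ℚ
indicator true  = 1ℚ
indicator false = 0ℚ

Pr≡𝔼 : {A : Set} (d : Dist A) (E : A → Bool) → Pr d E ≡ 𝔼 d (indicator ∘ E)
Pr≡𝔼 []            E = refl
Pr≡𝔼 ((p , a) ∷ d) E = cong₂ ℚ._+_ (weight (E a)) (Pr≡𝔼 d E)
  where
  weight : ∀ b → (if b then p else 0ℚ) ≡ p ℚ.* indicator b
  weight true  = sym (ℚP.*-identityʳ p)
  weight false = sym (ℚP.*-zeroʳ p)

*-monoˡ-≤ : ∀ {r p q} → 0ℚ ℚ.≤ r → p ℚ.≤ q → r ℚ.* p ℚ.≤ r ℚ.* q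
*-monoˡ-≤ {r} 0≤r = ℚP.*-monoˡ-≤-nonNeg r {{ℚ.nonNegative 0≤r}}

*-nonNeg : ∀ {a b} → 0ℚ ℚ.≤ a → 0ℚ ℚ.≤ b → 0ℚ ℚ.≤ a ℚ.* b
*-nonNeg {a} 0≤a 0≤b = subst (ℚ._≤ a ℚ.* _) (ℚP.*-zeroʳ a) (*-monoˡ-≤ 0≤a 0≤b)

+-nonNeg : ∀ {a b} → 0ℚ ℚ.≤ a → 0ℚ ℚ.≤ b → 0ℚ ℚ.≤ a ℚ.+ b
+-nonNeg {a} {b} 0≤a 0≤b = subst (ℚ._≤ a ℚ.+ b) (ℚP.+-identityʳ 0ℚ) (ℚP.+-mono-≤ 0≤a 0≤b)

0≤1 : 0ℚ ℚ.≤ 1ℚ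
0≤1 = ℚP.nonNegative⁻¹ 1ℚ

complement-nonNeg : ∀ {p} → p ℚ.≤ 1ℚ → 0ℚ ℚ.≤ 1ℚ ℚ.- p
complement-nonNeg {p} p≤1 = subst (ℚ._≤ 1ℚ ℚ.- p) (ℚP.+-inverseʳ p) (ℚP.+-monoˡ-≤ (ℚ.- p) p≤1)

complement-≤1 : ∀ {p} → 0ℚ ℚ.≤ p → 1ℚ ℚ.- p ℚ.≤ 1ℚ
complement-≤1 {p} 0≤p =
  subst (1ℚ ℚ.- p ℚ.≤_) (ℚP.+-identityʳ 1ℚ) (ℚP.+-monoʳ-≤ 1ℚ (ℚP.neg-antimono-≤ 0≤p))

convex-≤ : ∀ {p x y a b} → 0ℚ ℚ.≤ p → p ℚ.≤ 1ℚ → x ℚ.≤ a → y ℚ.≤ b →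
           p ℚ.* x ℚ.+ (1ℚ ℚ.- p) ℚ.* y ℚ.≤ p ℚ.* a ℚ.+ (1ℚ ℚ.- p) ℚ.* b
convex-≤ 0≤p p≤1 x≤a y≤b =
  ℚP.+-mono-≤ (*-monoˡ-≤ 0≤p x≤a) (*-monoˡ-≤ (complement-nonNeg p≤1) y≤b)

^-nonNeg : ∀ {x} k → 0ℚ ℚ.≤ x → 0ℚ ℚ.≤ x ^ℚ k
^-nonNeg zero    0≤x = 0≤1
^-nonNeg (suc k) 0≤x = *-nonNeg 0≤x (^-nonNeg k 0≤x)

^-≤1 : ∀ {x} k → 0ℚ ℚ.≤ x → x ℚ.≤ 1ℚ → x ^ℚ k ℚ.≤ 1ℚ
^-≤1 zero    0≤x x≤1 = ≤-refl
^-≤1 (suc k) 0≤x x≤1 =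
  ≤-trans (*-monoˡ-≤ 0≤x (^-≤1 k 0≤x x≤1)) (≤-trans (≤-reflexive (ℚP.*-identityʳ _)) x≤1)

open +-*-Solver using (solve; _:+_; _:*_; _:-_; con; _:=_)

convex-self : ∀ p c → p ℚ.* c ℚ.+ (1ℚ ℚ.- p) ℚ.* c ≡ c
convex-self = solve 2 (λ p c → p :* c :+ (con 1ℚ :- p) :* c := c) refl

2^⌊log2⌋≤ : ∀ n (rec : Acc ℕ._<_ (suc n)) → 2 ℕ.^ ⌊log2⌋ (suc n) rec ℕ.≤ suc n
2^⌊log2⌋≤ zero    _         = ℕP.≤-refl
2^⌊log2⌋≤ (suc k) (acc rec) = begin
  2 ℕ.* 2 ℕ.^ ⌊log2⌋ (suc h) _ ≤⟨ ℕP.*-monoʳ-≤ 2 (2^⌊log2⌋≤ h (rec _)) ⟩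
  2 ℕ.* suc h                 ≡⟨ ℕP.*-suc 2 h ⟩
  2 ℕ.+ 2 ℕ.* h               ≤⟨ ℕP.+-monoʳ-≤ 2 twice-half≤ ⟩
  suc (suc k)                 ∎
  where
  open ℕP.≤-Reasoning
  h : ℕ
  h = ℕ.⌊ k /2⌋
  twice-half≤ : 2 ℕ.* h ℕ.≤ k
  twice-half≤ = begin
    2 ℕ.* h                ≡⟨ cong (h ℕ.+_) (ℕP.+-identityʳ h) ⟩
    h ℕ.+ h                ≤⟨ ℕP.+-monoʳ-≤ h (ℕP.⌊n/2⌋≤⌈n/2⌉ k) ⟩
    h ℕ.+ ℕ.⌈ k /2⌉        ≡⟨ ℕP.⌊n/2⌋+⌈n/2⌉≡n k ⟩
    k                      ∎

2^⌊log₂⌋≤ : ∀ N .{{_ : NonZero N}} → 2 ℕ.^ ⌊log₂ N ⌋ ℕ.≤ N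
2^⌊log₂⌋≤ (suc n) = 2^⌊log2⌋≤ n _

-- normalize m n ≤ 1 whenever m ≤ n: both sides are divided by the same gcd.
normalize-≤1 : ∀ m n .{{_ : NonZero n}} → m ℕ.≤ n → normalize m n ℚ.≤ 1ℚ
normalize-≤1 m n m≤n = ℚ.*≤* (begin
  ℚ.↥ (normalize m n) ℤ.* + 1 ≡⟨ ℤP.*-identityʳ _ ⟩
  ℚ.↥ (normalize m n)         ≡⟨ ℚP.↥-mkℚ+ (m ℕ./ g) (n ℕ./ g) ⟩
  + (m ℕ./ g)                 ≤⟨ ℤ.+≤+ (ℕDM./-monoˡ-≤ g m≤n) ⟩
  + (n ℕ./ g)                 ≡⟨ sym (ℚP.↧-mkℚ+ (m ℕ./ g) (n ℕ./ g)) ⟩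
  ℚ.↧ (normalize m n)         ≡⟨ sym (ℤP.*-identityˡ _) ⟩
  + 1 ℤ.* ℚ.↧ (normalize m n) ∎)
  where
  open ℤP.≤-Reasoning
  g : ℕ
  g = ℕGCD.gcd m n
  instance
    g≢0 : NonZero g
    g≢0 = ℕ.≢-nonZero (ℕGCD.gcd[m,n]≢0 m n (inj₂ (ℕ.≢-nonZero⁻¹ n)))
    n/g≢0 : NonZero (n ℕ./ g)
    n/g≢0 = ℕ.≢-nonZero (ℕGCD.n/gcd[m,n]≢0 m n)

coin-nonNeg : ∀ N .{{_ : NonZero N}} r → 0ℚ ℚ.≤ coinProb N r
coin-nonNeg N r = ℚP.nonNegative⁻¹ _ {{ℚP.normalize-nonNeg (2 ℕ.^ r) N}}

coin-≤1 : ∀ N .{{_ : NonZero N}} {r} → r ℕ.≤ ⌊log₂ N ⌋ → coinProb N r ℚ.≤ 1ℚ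
coin-≤1 N r≤L =
  normalize-≤1 _ N (ℕP.≤-trans (ℕP.^-monoʳ-≤ 2 r≤L) (2^⌊log₂⌋≤ N))

isYes-true : ∀ {P : Set} (P? : Dec P) → P → ⌊ P? ⌋ ≡ true
isYes-true (yes _) _ = refl
isYes-true (no ¬p) p = ⊥-elim (¬p p)

isYes-false : ∀ {P : Set} (P? : Dec P) → ¬ P → ⌊ P? ⌋ ≡ false
isYes-false (yes p) ¬p = ⊥-elim (¬p p)
isYes-false (no _)  _  = refl

isYes-sound : ∀ {P : Set} (P? : Dec P) → ⌊ P? ⌋ ≡ true → P
isYes-sound (yes p) _ = p

isYes-cong : ∀ {P R : Set} (P? : Dec P) (R? : Dec R) → (P → R) → (R → P) → ⌊ P? ⌋ ≡ ⌊ R? ⌋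
isYes-cong (yes p) R? to from = sym (isYes-true R? (to p))
isYes-cong (no ¬p) R? to from = sym (isYes-false R? (¬p ∘ from))

true≢false : ¬ (true ≡ false)
true≢false ()

undominated-upward : ∀ m {x y} → below m x ≡ false → x ℤ.< y → below m y ≡ false
undominated-upward nothing  _      _   = refl
undominated-upward (just m) undom x<y =
  isYes-false (_ ℤ.<? m) (λ y<m → true≢false (trans (sym (isYes-true (_ ℤ.<? m) (ℤP.<-trans x<y y<m))) undom))

below-insert-larger : ∀ m {x y} → x ℤ.< y → below (insertMax m y) x ≡ true
below-insert-larger nothing  x<y = isYes-true (_ ℤ.<? _) x<y
below-insert-larger (just m) x<y = isYes-true (_ ℤ.<? _) (ℤP.<-≤-trans x<y (ℤP.i≤j⊔i m _))

below-insert-smaller : ∀ m {x y} → y ℤ.< x → below (insertMax m y) x ≡ below m x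
below-insert-smaller nothing  y<x = isYes-false (_ ℤ.<? _) (ℤP.<-asym y<x)
below-insert-smaller (just m) {x} {y} y<x = isYes-cong (x ℤ.<? m ℤ.⊔ y) (x ℤ.<? m) to from
  where
  to : x ℤ.< m ℤ.⊔ y → x ℤ.< m
  to x<m⊔y with ℤP.⊔-sel m y
  ... | inj₁ m⊔y≡m = subst (x ℤ.<_) m⊔y≡m x<m⊔y
  ... | inj₂ m⊔y≡y = ⊥-elim (ℤP.<-asym y<x (subst (x ℤ.<_) m⊔y≡y x<m⊔y))
  from : x ℤ.< m → x ℤ.< m ℤ.⊔ y
  from x<m = ℤP.<-≤-trans x<m (ℤP.i≤i⊔j m y)

below-insert-mono : ∀ m y {x} → below m x ≡ true → below (insertMax m y) x ≡ true
below-insert-mono (just m) y {x} dom =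
  isYes-true (_ ℤ.<? _) (ℤP.<-≤-trans (isYes-sound (x ℤ.<? m) dom) (ℤP.i≤i⊔j m y))

deactivate-self : ∀ {n} (j : Fin n) act → deactivate j act j ≡ false
deactivate-self j act rewrite isYes-true (j FinP.≟ j) refl = refl

deactivate-other : ∀ {n} {j k : Fin n} act → ¬ (k ≡ j) → deactivate j act k ≡ act k
deactivate-other {j = j} {k} act k≢j rewrite isYes-false (k FinP.≟ j) k≢j = refl

record Split {n : ℕ} (i : Fin n) : Set where
  field
    before        : List (Fin n)
    after         : List (Fin n)
    allFin≡       : allFin n ≡ before ++ i ∷ after
    length-before : length before ≡ toℕ i
    before<       : All (Fin._< i) before
    after>        : All (i Fin.<_) after

split : ∀ {n} (i : Fin n) → Split i
split {suc n} Fin.zero = record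
  { before = [] ; after = tabulate Fin.suc ; allFin≡ = refl ; length-before = refl
  ; before< = [] ; after> = AllP.tabulate⁺ (λ _ → ℕ.z<s) }
split {suc n} (Fin.suc i) = record
  { before        = Fin.zero ∷ map Fin.suc before
  ; after         = map Fin.suc after
  ; allFin≡       = cong (Fin.zero ∷_) (begin
      tabulate Fin.suc              ≡⟨ sym (ListP.map-tabulate id Fin.suc) ⟩
      map Fin.suc (allFin n)        ≡⟨ cong (map Fin.suc) allFin≡ ⟩
      map Fin.suc (before ++ i ∷ after) ≡⟨ ListP.map-++ Fin.suc before (i ∷ after) ⟩
      map Fin.suc before ++ Fin.suc i ∷ map Fin.suc after ∎)
  ; length-before = cong suc (trans (ListP.length-map Fin.suc before) length-before)
  ; before<       = ℕ.z<s ∷ AllP.map⁺ (All.map ℕ.s<s before<)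
  ; after>        = AllP.map⁺ (All.map ℕ.s<s after>)
  }
  where
  open Split (split i)
  open ≡-Reasoning

fire : {n : ℕ} → (Fin n → ℤ) → Fin n → State n → State n
fire v j (act , best) = deactivate j act , insertMax best (v j)

module Step {n : ℕ} (v : Fin n → ℤ) (p : ℚ) (0≤p : 0ℚ ℚ.≤ p) (p≤1 : p ℚ.≤ 1ℚ) where

  q : ℚ
  q = 1ℚ ℚ.- p

  𝔼-coin : (A B : State n) (V : State n → ℚ) →
           𝔼 (bind (coin p) (λ b → if b then return A else return B)) V ≡ p ℚ.* V A ℚ.+ q ℚ.* V B
  𝔼-coin A B V = trans (𝔼-bind (coin p) (λ b → if b then return A else return B) V)
    (cong₂ ℚ._+_ (cong (p ℚ.*_) (𝔼-return A V))
                 (trans (ℚP.+-identityʳ (q ℚ.* 𝔼 (return B) V)) (cong (q ℚ.*_) (𝔼-return B V))))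

  data StepCases (prev : Maybe ℤ) (j : Fin n) (s : State n) : Set where
    fires : proj₁ s j ≡ true → below prev (v j) ≡ false →
            (∀ V → 𝔼 (stepNode v p prev j s) V ≡ p ℚ.* V (fire v j s) ℚ.+ q ℚ.* V s) →
            StepCases prev j s
    idles : (proj₁ s j ≡ false ⊎ below prev (v j) ≡ true) →
            (∀ V → 𝔼 (stepNode v p prev j s) V ≡ V s) →
            StepCases prev j s

  fires-𝔼 : ∀ prev j act best → act j ≡ true → below prev (v j) ≡ false → ∀ V →
            𝔼 (stepNode v p prev j (act , best)) V ≡ p ℚ.* V (fire v j (act , best)) ℚ.+ q ℚ.* V (act , best)
  fires-𝔼 prev j act best active undom V rewrite active | undom = 𝔼-coin _ _ V

  inactive-𝔼 : ∀ prev j act best → act j ≡ false → ∀ V →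
               𝔼 (stepNode v p prev j (act , best)) V ≡ V (act , best)
  inactive-𝔼 prev j act best inactive V rewrite inactive = 𝔼-return _ V

  dominated-𝔼 : ∀ prev j act best → act j ≡ true → below prev (v j) ≡ true → ∀ V →
                𝔼 (stepNode v p prev j (act , best)) V ≡ V (act , best)
  dominated-𝔼 prev j act best active dom V rewrite active | dom = 𝔼-return _ V

  stepCases : ∀ prev j s → StepCases prev j s
  stepCases prev j (act , best) with act j in active | below prev (v j) in dom
  ... | true  | false = fires active dom (fires-𝔼 prev j act best active dom)
  ... | true  | true  = idles (inj₂ dom) (dominated-𝔼 prev j act best active dom)
  ... | false | _     = idles (inj₁ active) (inactive-𝔼 prev j act best active)

  step-≤ : ∀ prev j s (V : State n → ℚ) {b} →
           (proj₁ s j ≡ true → below prev (v j) ≡ false → V (fire v j s) ℚ.≤ b) → V s ℚ.≤ b →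
           𝔼 (stepNode v p prev j s) V ℚ.≤ b
  step-≤ prev j s V {b} fire≤ stay≤ with stepCases prev j s
  ... | fires active undom 𝔼≡ = subst (ℚ._≤ b) (sym (𝔼≡ V))
        (≤-trans (convex-≤ 0≤p p≤1 (fire≤ active undom) stay≤) (≤-reflexive (convex-self p b)))
  ... | idles _ 𝔼≡ = subst (ℚ._≤ b) (sym (𝔼≡ V)) stay≤

  step-mono : ∀ prev j s (V W : State n → ℚ) → (∀ s' → V s' ℚ.≤ W s') →
              𝔼 (stepNode v p prev j s) V ℚ.≤ 𝔼 (stepNode v p prev j s) W
  step-mono prev j s V W V≤W with stepCases prev j s
  ... | fires _ _ 𝔼≡ = subst₂ ℚ._≤_ (sym (𝔼≡ V)) (sym (𝔼≡ W)) (convex-≤ 0≤p p≤1 (V≤W _) (V≤W _))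
  ... | idles _ 𝔼≡   = subst₂ ℚ._≤_ (sym (𝔼≡ V)) (sym (𝔼≡ W)) (V≤W s)

  nodes-cons : ∀ prev j js s (V : State n → ℚ) →
               𝔼 (roundNodes v p prev (j ∷ js) s) V ≡
               𝔼 (stepNode v p prev j s) (λ s' → 𝔼 (roundNodes v p prev js s') V)
  nodes-cons prev j js s V = 𝔼-bind (stepNode v p prev j s) (roundNodes v p prev js) V

  nodes-++ : ∀ prev js ks s (V : State n → ℚ) →
             𝔼 (roundNodes v p prev (js ++ ks) s) V ≡
             𝔼 (roundNodes v p prev js s) (λ s' → 𝔼 (roundNodes v p prev ks s') V)
  nodes-++ prev []       ks s V = sym (𝔼-return s (λ s' → 𝔼 (roundNodes v p prev ks s') V))
  nodes-++ prev (j ∷ js) ks s V =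
    trans (nodes-cons prev j (js ++ ks) s V)
      (trans (𝔼-cong (stepNode v p prev j s) (λ s' → nodes-++ prev js ks s' V))
             (sym (nodes-cons prev j js s _)))

  nodes-mono : ∀ prev js s (V W : State n → ℚ) → (∀ s' → V s' ℚ.≤ W s') →
               𝔼 (roundNodes v p prev js s) V ℚ.≤ 𝔼 (roundNodes v p prev js s) W
  nodes-mono prev []       s V W V≤W =
    subst₂ ℚ._≤_ (sym (𝔼-return s V)) (sym (𝔼-return s W)) (V≤W s)
  nodes-mono prev (j ∷ js) s V W V≤W =
    subst₂ ℚ._≤_ (sym (nodes-cons prev j js s V)) (sym (nodes-cons prev j js s W))
      (step-mono prev j s _ _ (λ s' → nodes-mono prev js s' V W V≤W))

  round-mono : ∀ s (V W : State n → ℚ) → (∀ s' → V s' ℚ.≤ W s') →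
               𝔼 (doRound v p s) V ℚ.≤ 𝔼 (doRound v p s) W
  round-mono (act , best) = nodes-mono best (allFin n) (act , best)

  nodes-invariant : ∀ prev {Q : Fin n → Set} (Inv : State n → Set) (V : State n → ℚ) (b : ℚ) →
    (∀ {j} s → Q j → Inv s → proj₁ s j ≡ true → below prev (v j) ≡ false → Inv (fire v j s)) →
    (∀ s → Inv s → V s ℚ.≤ b) →
    ∀ js → All Q js → ∀ s → Inv s → 𝔼 (roundNodes v p prev js s) V ℚ.≤ b
  nodes-invariant prev Inv V b keep bound [] [] s inv =
    subst (ℚ._≤ b) (sym (𝔼-return s V)) (bound s inv)
  nodes-invariant prev Inv V b keep bound (j ∷ js) (qj ∷ qjs) s inv =
    subst (ℚ._≤ b) (sym (nodes-cons prev j js s V))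
      (step-≤ prev j s _ (λ active undom → rest (fire v j s) (keep s qj inv active undom)) (rest s inv))
    where
    rest : ∀ s → Inv s → 𝔼 (roundNodes v p prev js s) V ℚ.≤ b
    rest = nodes-invariant prev Inv V b keep bound js qjs

module Potential {n : ℕ} (v : Fin n → ℤ) (decreasing : ∀ j k → j Fin.< k → v k ℤ.< v j)
                 (i : Fin n) where

  HigherActive : (Fin n → Bool) → Set
  HigherActive act = ∀ j → j Fin.< i → act j ≡ true

  higherActive? : ∀ act → Dec (HigherActive act)
  higherActive? act = FinP.all? (λ j → j FinP.<? i →-dec act j BoolP.≟ true)

  higherActive : (Fin n → Bool) → Bool
  higherActive act = ⌊ higherActive? act ⌋

  higherActive-deactivate : ∀ {j} act → i Fin.< j →
                            higherActive (deactivate j act) ≡ higherActive act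
  higherActive-deactivate {j} act i<j = isYes-cong (higherActive? (deactivate j act)) (higherActive? act)
    (λ on k k<i → trans (sym (deactivate-other act (k≢j k<i))) (on k k<i))
    (λ on k k<i → trans (deactivate-other act (k≢j k<i)) (on k k<i))
    where
    k≢j : ∀ {k} → k Fin.< i → ¬ (k ≡ j)
    k≢j k<i refl = ℕP.<-asym k<i i<j

  -- Potential: 1 once i has sent, 0 once i is dominated, h while i is fresh,
  -- and the trivial bound 1 if a node of larger value has sent without dominating i
  -- (a state that never occurs in a run).
  φ : ℚ → Bool → Bool → Bool → ℚ
  φ h false _     _     = 1ℚ
  φ h true  true  _     = 0ℚ
  φ h true  false true  = h
  φ h true  false false = 1ℚ

  φ-cong : ∀ h {a a' b b' g g'} → a ≡ a' → b ≡ b' → g ≡ g' → φ h a b g ≡ φ h a' b' g'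
  φ-cong h refl refl refl = refl

  Φ : ℚ → State n → ℚ
  Φ h (act , best) = φ h (act i) (below best (v i)) (higherActive act)

  Φ-fire-self : ∀ h s → Φ h (fire v i s) ≡ 1ℚ
  Φ-fire-self h (act , best) = φ-cong h (deactivate-self i act) refl refl

  Φ-fire-lower : ∀ h s {j} → i Fin.< j → Φ h (fire v j s) ≡ Φ h s
  Φ-fire-lower h (act , best) {j} i<j =
    φ-cong h (deactivate-other act (λ { refl → ℕP.<-irrefl refl i<j }))
             (below-insert-smaller best (decreasing i j i<j))
             (higherActive-deactivate act i<j)

  Φ-initial : ∀ h → Φ h (initial n) ≡ h
  Φ-initial h = cong (φ h true false) (isYes-true (higherActive? (λ _ → true)) (λ _ _ → refl))

  sent≤Φ₀ : ∀ s → indicator (sent i s) ℚ.≤ Φ 0ℚ s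
  sent≤Φ₀ (act , best) = table (act i) (below best (v i)) (higherActive act)
    where
    table : ∀ a b g → indicator (not a) ℚ.≤ φ 0ℚ a b g
    table false _     _     = ≤-refl
    table true  true  _     = ≤-refl
    table true  false true  = ≤-refl
    table true  false false = 0≤1

  module InRound (p : ℚ) (0≤p : 0ℚ ℚ.≤ p) (p≤1 : p ℚ.≤ 1ℚ) where
    open Step v p 0≤p p≤1

    -- Bound on the remaining round when c nodes of larger value, and then i, are
    -- still to toss their coins: i sends with probability p and, undominated, stays
    -- fresh only if all c+1 coins fail.
    θ : ℚ → ℕ → Bool → Bool → Bool → ℚ
    θ h c false _     _     = 1ℚ
    θ h c true  true  _     = p
    θ h c true  false true  = p ℚ.+ q ^ℚ suc c ℚ.* h
    θ h c true  false false = 1ℚ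

    θ-cong : ∀ h c {a a' b b' g g'} → a ≡ a' → b ≡ b' → g ≡ g' → θ h c a b g ≡ θ h c a' b' g'
    θ-cong h c refl refl refl = refl

    Θ : ℚ → ℕ → State n → ℚ
    Θ h c (act , best) = θ h c (act i) (below best (v i)) (higherActive act)

    Θ-fire-higher : ∀ h c s {j} → j Fin.< i →
                    Θ h c (fire v j s) ≡ θ h c (proj₁ s i) true (higherActive (deactivate j (proj₁ s)))
    Θ-fire-higher h c (act , best) {j} j<i =
      θ-cong h c (deactivate-other act (λ { refl → ℕP.<-irrefl refl j<i }))
                 (below-insert-larger best (decreasing j i j<i)) refl

    higher-coin : ∀ h c a b g g' → p ℚ.* θ h c a true g' ℚ.+ q ℚ.* θ h c a b g ℚ.≤ θ h (suc c) a b g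
    higher-coin h c false b     g     g' = ≤-reflexive (convex-self p 1ℚ)
    higher-coin h c true  true  g     g' = ≤-reflexive (convex-self p p)
    higher-coin h c true  false true  g' = ≤-reflexive
      (solve 3 (λ p Q h → p :* p :+ (con 1ℚ :- p) :* (p :+ Q :* h) := p :+ ((con 1ℚ :- p) :* Q) :* h)
             refl p (q ^ℚ suc c) h)
    higher-coin h c true  false false g' = ≤-trans
      (ℚP.+-monoˡ-≤ (q ℚ.* 1ℚ) (≤-trans (*-monoˡ-≤ 0≤p p≤1) (≤-reflexive (ℚP.*-identityʳ p))))
      (≤-reflexive (trans (cong (ℚ._+ q ℚ.* 1ℚ) (sym (ℚP.*-identityʳ p))) (convex-self p 1ℚ)))

    θ-stale : ∀ h c a b {g} → g ≡ false → θ h c a b g ≡ θ h (suc c) a b g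
    θ-stale h c false _     refl = refl
    θ-stale h c true  true  refl = refl
    θ-stale h c true  false refl = refl

    -- One larger-valued node moves: if it fires it dominates i, if it is inactive
    -- then i is not fresh, and it cannot be dominated while i is not.

    higher-step : ∀ h prev → below prev (v i) ≡ false → ∀ c {j} → j Fin.< i → ∀ s →
                  𝔼 (stepNode v p prev j s) (Θ h c) ℚ.≤ Θ h (suc c) s
    higher-step h prev undom c {j} j<i (act , best) with stepCases prev j (act , best)
    ... | fires _ _ 𝔼≡ = begin
      𝔼 (stepNode v p prev j (act , best)) (Θ h c)
        ≡⟨ 𝔼≡ (Θ h c) ⟩
      p ℚ.* Θ h c (fire v j (act , best)) ℚ.+ q ℚ.* Θ h c (act , best)
        ≡⟨ cong (λ x → p ℚ.* x ℚ.+ q ℚ.* Θ h c (act , best)) (Θ-fire-higher h c (act , best) j<i) ⟩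
      p ℚ.* θ h c (act i) true _ ℚ.+ q ℚ.* Θ h c (act , best)
        ≤⟨ higher-coin h c (act i) (below best (v i)) (higherActive act) _ ⟩
      Θ h (suc c) (act , best) ∎
      where open ℚP.≤-Reasoning
    ... | idles (inj₁ inactive) 𝔼≡ =
      ≤-reflexive (trans (𝔼≡ (Θ h c)) (θ-stale h c (act i) (below best (v i)) stale))
      where
      stale : higherActive act ≡ false
      stale = isYes-false (higherActive? act) (λ on → true≢false (trans (sym (on j j<i)) inactive))
    ... | idles (inj₂ dominated) _ =
      ⊥-elim (true≢false (trans (sym dominated) (undominated-upward prev undom (decreasing j i j<i))))

    before-i : ∀ h prev → below prev (v i) ≡ false → ∀ js → All (Fin._< i) js → ∀ s →
               𝔼 (roundNodes v p prev js s) (Θ h 0) ℚ.≤ Θ h (length js) s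
    before-i h prev undom []       []           s = ≤-reflexive (𝔼-return s (Θ h 0))
    before-i h prev undom (j ∷ js) (j<i ∷ js<i) s = begin
      𝔼 (roundNodes v p prev (j ∷ js) s) (Θ h 0)
        ≡⟨ nodes-cons prev j js s (Θ h 0) ⟩
      𝔼 (stepNode v p prev j s) (λ s' → 𝔼 (roundNodes v p prev js s') (Θ h 0))
        ≤⟨ step-mono prev j s _ _ (before-i h prev undom js js<i) ⟩
      𝔼 (stepNode v p prev j s) (Θ h (length js))
        ≤⟨ higher-step h prev undom (length js) j<i s ⟩
      Θ h (length (j ∷ js)) s ∎
      where open ℚP.≤-Reasoning

    own-coin : ∀ h {a} b g → a ≡ true → p ℚ.* 1ℚ ℚ.+ q ℚ.* φ h a b g ℚ.≤ θ h 0 a b g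
    own-coin h true  _     refl = ≤-reflexive
      (solve 1 (λ p → p :* con 1ℚ :+ (con 1ℚ :- p) :* con 0ℚ := p) refl p)
    own-coin h false true  refl = ≤-reflexive
      (solve 2 (λ p h → p :* con 1ℚ :+ (con 1ℚ :- p) :* h := p :+ ((con 1ℚ :- p) :* con 1ℚ) :* h)
             refl p h)
    own-coin h false false refl = ≤-reflexive (convex-self p 1ℚ)

    inactive-φ≡θ : ∀ h c {a} b g → a ≡ false → φ h a b g ≡ θ h c a b g
    inactive-φ≡θ h c _ _ refl = refl

    at-i : ∀ h prev → below prev (v i) ≡ false → ∀ s →
           𝔼 (stepNode v p prev i s) (Φ h) ℚ.≤ Θ h 0 s
    at-i h prev undom (act , best) with stepCases prev i (act , best)
    ... | fires active _ 𝔼≡ = begin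
      𝔼 (stepNode v p prev i (act , best)) (Φ h)
        ≡⟨ 𝔼≡ (Φ h) ⟩
      p ℚ.* Φ h (fire v i (act , best)) ℚ.+ q ℚ.* Φ h (act , best)
        ≡⟨ cong (λ x → p ℚ.* x ℚ.+ q ℚ.* Φ h (act , best)) (Φ-fire-self h (act , best)) ⟩
      p ℚ.* 1ℚ ℚ.+ q ℚ.* Φ h (act , best)
        ≤⟨ own-coin h (below best (v i)) (higherActive act) active ⟩
      Θ h 0 (act , best) ∎
      where open ℚP.≤-Reasoning
    ... | idles (inj₁ inactive) 𝔼≡ =
      ≤-reflexive (trans (𝔼≡ (Φ h)) (inactive-φ≡θ h 0 (below best (v i)) (higherActive act) inactive))
    ... | idles (inj₂ dominated) _ = ⊥-elim (true≢false (trans (sym dominated) undom))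

    after-i : ∀ h prev js → All (i Fin.<_) js → ∀ s →
              𝔼 (roundNodes v p prev js s) (Φ h) ℚ.≤ Φ h s
    after-i h prev js js>i s =
      nodes-invariant prev (λ s' → Φ h s' ≡ Φ h s) (Φ h) (Φ h s)
        (λ s' i<j same _ _ → trans (Φ-fire-lower h s' i<j) same) (λ _ → ≤-reflexive) js js>i s refl

    dominated-round : ∀ h H s → below (proj₂ s) (v i) ≡ true →
                      𝔼 (doRound v p s) (Φ h) ℚ.≤ Φ H s
    dominated-round h H (act , best) dom =
      nodes-invariant best Frozen (Φ h) (Φ H (act , best)) keep bound
        (allFin n) (All.universal (λ _ → tt) (allFin n)) (act , best) (refl , dom)
      where
      Frozen : State n → Set
      Frozen (act' , best') = act' i ≡ act i × below best' (v i) ≡ true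
      keep : ∀ {j} s → ⊤ → Frozen s → proj₁ s j ≡ true → below best (v j) ≡ false → Frozen (fire v j s)
      keep {j} (act' , best') _ (same , dom') _ undom =
        trans (deactivate-other act' i≢j) same , below-insert-mono best' (v j) dom'
        where
        i≢j : ¬ (i ≡ j)
        i≢j refl = true≢false (trans (sym dom) undom)
      frozen : ∀ a g g' → φ h a true g ≡ φ H a true g'
      frozen false _ _ = refl
      frozen true  _ _ = refl
      bound : ∀ s → Frozen s → Φ h s ℚ.≤ Φ H (act , best)
      bound (act' , best') (same , dom') rewrite same | dom' | dom =
        ≤-reflexive (frozen (act i) (higherActive act') (higherActive act))

    θ≡φ-undominated : ∀ h c {a} b g → b ≡ false → θ h c a b g ≡ φ (p ℚ.+ q ^ℚ suc c ℚ.* h) a b g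
    θ≡φ-undominated h c {false} _ _     refl = refl
    θ≡φ-undominated h c {true}  _ true  refl = refl
    θ≡φ-undominated h c {true}  _ false refl = refl

    undominated-round : ∀ h s → below (proj₂ s) (v i) ≡ false →
                        𝔼 (doRound v p s) (Φ h) ℚ.≤ Φ (p ℚ.+ q ^ℚ suc (toℕ i) ℚ.* h) s
    undominated-round h (act , best) undom = begin
      𝔼 (roundNodes v p best (allFin n) s) (Φ h)
        ≡⟨ cong (λ js → 𝔼 (roundNodes v p best js s) (Φ h)) allFin≡ ⟩
      𝔼 (roundNodes v p best (before ++ i ∷ after) s) (Φ h)
        ≡⟨ nodes-++ best before (i ∷ after) s (Φ h) ⟩
      𝔼 (roundNodes v p best before s) (λ s' → 𝔼 (roundNodes v p best (i ∷ after) s') (Φ h))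
        ≤⟨ nodes-mono best before s _ _ i-then-after ⟩
      𝔼 (roundNodes v p best before s) (Θ h 0)
        ≤⟨ before-i h best undom before before< s ⟩
      Θ h (length before) s
        ≡⟨ cong (λ c → Θ h c s) length-before ⟩
      Θ h (toℕ i) s
        ≡⟨ θ≡φ-undominated h (toℕ i) {act i} (below best (v i)) (higherActive act) undom ⟩
      Φ (p ℚ.+ q ^ℚ suc (toℕ i) ℚ.* h) s ∎
      where
      open ℚP.≤-Reasoning
      open Split (split i)
      s : State n
      s = (act , best)
      i-then-after : ∀ s' → 𝔼 (roundNodes v p best (i ∷ after) s') (Φ h) ℚ.≤ Θ h 0 s'
      i-then-after s' = ≤-trans (≤-reflexive (nodes-cons best i after s' (Φ h)))
        (≤-trans (step-mono best i s' _ _ (after-i h best after after>)) (at-i h best undom s'))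

    round-bound : ∀ h s → 𝔼 (doRound v p s) (Φ h) ℚ.≤ Φ (p ℚ.+ q ^ℚ suc (toℕ i) ℚ.* h) s
    round-bound h s = by-dominance (below (proj₂ s) (v i)) refl
      where
      by-dominance : ∀ b → below (proj₂ s) (v i) ≡ b →
                     𝔼 (doRound v p s) (Φ h) ℚ.≤ Φ (p ℚ.+ q ^ℚ suc (toℕ i) ℚ.* h) s
      by-dominance true  dom   = dominated-round h (p ℚ.+ q ^ℚ suc (toℕ i) ℚ.* h) s dom
      by-dominance false undom = undominated-round h s undom

horner : (a c : ℕ → ℚ) → ℕ → ℚ
horner a c zero    = 0ℚ
horner a c (suc k) = a 0 ℚ.+ c 0 ℚ.* horner (a ∘ suc) (c ∘ suc) k

sumFrom1-front : ∀ k (f : ℕ → ℚ) → sumFrom1 (suc k) f ≡ f 1 ℚ.+ sumFrom1 k (f ∘ suc)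
sumFrom1-front zero    f = trans (ℚP.+-identityˡ (f 1)) (sym (ℚP.+-identityʳ (f 1)))
sumFrom1-front (suc k) f = trans (cong (ℚ._+ f (suc (suc k))) (sumFrom1-front k f))
                                 (ℚP.+-assoc (f 1) (sumFrom1 k (f ∘ suc)) (f (suc (suc k))))

sumFrom1-cong : ∀ k (f g : ℕ → ℚ) → (∀ t → f (suc t) ≡ g (suc t)) → sumFrom1 k f ≡ sumFrom1 k g
sumFrom1-cong zero    f g f≗g = refl
sumFrom1-cong (suc k) f g f≗g = cong₂ ℚ._+_ (sumFrom1-cong k f g f≗g) (f≗g k)

sumFrom1-nonNeg : ∀ k (f : ℕ → ℚ) → (∀ t → suc t ℕ.≤ k → 0ℚ ℚ.≤ f (suc t)) → 0ℚ ℚ.≤ sumFrom1 k f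
sumFrom1-nonNeg zero    f nonNeg = ≤-refl
sumFrom1-nonNeg (suc k) f nonNeg =
  +-nonNeg (sumFrom1-nonNeg k f (λ t t<k → nonNeg t (ℕP.m≤n⇒m≤1+n t<k))) (nonNeg k ℕP.≤-refl)

-- With nonnegative aₜ and cₜ ∈ [0,1], dropping all but the last factor of each
-- product c₀⋯c_{t-1} only increases the Horner expression.
horner≤sum : ∀ (a c : ℕ → ℚ) k → (∀ t → 0ℚ ℚ.≤ a t) →
             (∀ {t} → t ℕ.< k → 0ℚ ℚ.≤ c t × c t ℚ.≤ 1ℚ) →
             horner a c (suc k) ℚ.≤ a 0 ℚ.+ sumFrom1 k (λ t → a t ℚ.* c (t ∸ 1))
horner≤sum a c zero    a≥0 c∈[0,1] = ≤-reflexive (cong (a 0 ℚ.+_) (ℚP.*-zeroʳ (c 0)))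
horner≤sum a c (suc k) a≥0 c∈[0,1] = begin
  a 0 ℚ.+ c 0 ℚ.* horner (a ∘ suc) (c ∘ suc) (suc k)
    ≤⟨ ℚP.+-monoʳ-≤ (a 0) (*-monoˡ-≤ c₀≥0 (horner≤sum (a ∘ suc) (c ∘ suc) k (a≥0 ∘ suc) (c∈[0,1] ∘ ℕ.s≤s))) ⟩
  a 0 ℚ.+ c 0 ℚ.* (a 1 ℚ.+ S)
    ≡⟨ cong (a 0 ℚ.+_) (ℚP.*-distribˡ-+ (c 0) (a 1) S) ⟩
  a 0 ℚ.+ (c 0 ℚ.* a 1 ℚ.+ c 0 ℚ.* S)
    ≤⟨ ℚP.+-monoʳ-≤ (a 0) (ℚP.+-monoʳ-≤ (c 0 ℚ.* a 1) c₀S≤S) ⟩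
  a 0 ℚ.+ (c 0 ℚ.* a 1 ℚ.+ S)
    ≡⟨ cong (a 0 ℚ.+_) (sym (trans (sumFrom1-front k f)
         (cong₂ ℚ._+_ (ℚP.*-comm (a 1) (c 0)) (sumFrom1-cong k _ _ (λ _ → refl))))) ⟩
  a 0 ℚ.+ sumFrom1 (suc k) f ∎
  where
  open ℚP.≤-Reasoning
  f : ℕ → ℚ
  f t = a t ℚ.* c (t ∸ 1)
  S : ℚ
  S = sumFrom1 k (λ t → a (suc t) ℚ.* c (suc (t ∸ 1)))
  c₀≥0 : 0ℚ ℚ.≤ c 0
  c₀≥0 = proj₁ (c∈[0,1] ℕ.z<s)
  S≥0 : 0ℚ ℚ.≤ S
  S≥0 = sumFrom1-nonNeg k _ (λ t t<k → *-nonNeg (a≥0 _) (proj₁ (c∈[0,1] (ℕ.s≤s t<k))))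
  c₀S≤S : c 0 ℚ.* S ℚ.≤ S
  c₀S≤S = ≤-trans (ℚP.*-monoʳ-≤-nonNeg S {{ℚ.nonNegative S≥0}} (proj₂ (c∈[0,1] ℕ.z<s)))
                  (≤-reflexive (ℚP.*-identityˡ S))

module AllRounds {n : ℕ} (N : ℕ) .{{_ : NonZero N}} (v : Fin n → ℤ)
                 (decreasing : ∀ j k → j Fin.< k → v k ℤ.< v j) (i : Fin n) where
  open Potential v decreasing i

  P : ℕ → ℚ
  P r = coinProb N r

  -- probability that none of the nodes 0..i succeeds with coin probability P r
  Q : ℕ → ℚ
  Q r = (1ℚ ℚ.- P r) ^ℚ suc (toℕ i)

  rounds-bound : ∀ k (g : ℕ → ℕ) → (∀ {t} → t ℕ.< k → P (g t) ℚ.≤ 1ℚ) → ∀ s →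
                 𝔼 (runRounds N v (applyUpTo g k) s) (indicator ∘ sent i)
                   ℚ.≤ Φ (horner (P ∘ g) (Q ∘ g) k) s
  rounds-bound zero    g coins≤1 s = ≤-trans (≤-reflexive (𝔼-return s (indicator ∘ sent i))) (sent≤Φ₀ s)
  rounds-bound (suc k) g coins≤1 s = begin
    𝔼 (runRounds N v (applyUpTo g (suc k)) s) (indicator ∘ sent i)
      ≡⟨ 𝔼-bind (doRound v (P (g 0)) s) _ _ ⟩
    𝔼 (doRound v (P (g 0)) s) (λ s' → 𝔼 (runRounds N v (applyUpTo (g ∘ suc) k) s') (indicator ∘ sent i))
      ≤⟨ round-mono s _ _ (rounds-bound k (g ∘ suc) (coins≤1 ∘ ℕ.s≤s)) ⟩
    𝔼 (doRound v (P (g 0)) s) (Φ (horner (P ∘ g ∘ suc) (Q ∘ g ∘ suc) k))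
      ≤⟨ round-bound _ s ⟩
    Φ (horner (P ∘ g) (Q ∘ g) (suc k)) s ∎
    where
    open ℚP.≤-Reasoning
    open Step v (P (g 0)) (coin-nonNeg N (g 0)) (coins≤1 ℕ.z<s) using (round-mono)
    open InRound (P (g 0)) (coin-nonNeg N (g 0)) (coins≤1 ℕ.z<s) using (round-bound)

-- The theorem.  Here P 0 = 2^0/N is the 1/N of the statement, and the bound
-- holds without using the hypothesis n ≤ N.
lemma3 : (n N : ℕ) → .{{_ : NonZero N}} → n ℕ.≤ N →
         (v : Fin n → ℤ) → (∀ j k → j Fin.< k → v k ℤ.< v j) →
         (i : Fin n) →
         Pr (maximumProtocol N v) (sent i)
           ℚ.≤ (+ 1) ℚ./ N
               ℚ.+ sumFrom1 ⌊log₂ N ⌋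
                     (λ r → coinProb N r ℚ.* ((1ℚ ℚ.- coinProb N (r ∸ 1)) ^ℚ suc (toℕ i)))
lemma3 n N _ v decreasing i = begin
  Pr (maximumProtocol N v) (sent i)
    ≡⟨ Pr≡𝔼 (maximumProtocol N v) (sent i) ⟩
  𝔼 (runRounds N v (upTo (suc L)) (initial n)) (indicator ∘ sent i)
    ≤⟨ rounds-bound (suc L) id (λ t<1+L → coin-≤1 N (ℕP.≤-pred t<1+L)) (initial n) ⟩
  Φ (horner P Q (suc L)) (initial n)
    ≡⟨ Φ-initial _ ⟩
  horner P Q (suc L)
    ≤⟨ horner≤sum P Q L (coin-nonNeg N) Q∈[0,1] ⟩
  P 0 ℚ.+ sumFrom1 L (λ r → P r ℚ.* Q (r ∸ 1)) ∎
  where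
  open ℚP.≤-Reasoning
  open AllRounds N v decreasing i
  open Potential v decreasing i using (Φ; Φ-initial)
  L : ℕ
  L = ⌊log₂ N ⌋
  Q∈[0,1] : ∀ {t} → t ℕ.< L → 0ℚ ℚ.≤ Q t × Q t ℚ.≤ 1ℚ
  Q∈[0,1] {t} t<L = ^-nonNeg (suc (toℕ i)) 1-P≥0 , ^-≤1 (suc (toℕ i)) 1-P≥0 (complement-≤1 (coin-nonNeg N t))
    where
    1-P≥0 : 0ℚ ℚ.≤ 1ℚ ℚ.- P t
    1-P≥0 = complement-nonNeg (coin-≤1 N (ℕP.<⇒≤ t<L))
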